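{- For an ultrafilter $p$ on $\omega$, $\mathscr G^p$ is the smallest family of ultrafilters on $\omega$ that (1) contains all principal ultrafilters, (2) contains $p$, (3) is closed under Rudin–Keisler images (by functions $f:\omega\to\omega$), and (4) is closed under Blass–Frolík sums.
   Context: The Rudin–Keisler image of $u$ under $f:\omega\to\omega$ is $f(u)=\{B : f^{ -1}[B]\in u\}$. The Blass–Frolík sum of $\langle u_n : n<\omega\rangle$ indexed by $u$ is $\{A\subseteq\omega\times\omega : \{n : \{m : (n,m)\in A\}\in u_n\}\in u\}$ (an ultrafilter on the countable set $\omega\times\omega$, identified with one on $\omega$ via a bijection). $p\text{ - }\lim_n u_n=\{A : \{n : A\in u_n\}\in p\}$. $\mathscr G^p_1$ = principal ultrafilters on $\omega$, $\mathscr G^p_{\alpha+1}=\{p\text{ - }\lim_n u_n : u_n\in\mathscr G^p_\alpha\text{ for all } n\}$, $\mathscr G^p_\alpha=\bigcup_{\xi<\alpha}\mathscr G^p_\xi$ for limit $\alpha$, $\mathscr G^p=\bigcup_{\alpha\ge1}\mathscr G^p_\alpha$. -}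

module Defs where

open import Data.Nat using (ℕ)
open import Data.Bool using (Bool; true; false; not; _∧_)
open import Data.Product using (Σ; _×_; _,_)
open import Data.Sum using (_⊎_)
open import Function using (_∘_)
open import Function.Bundles using (_⤖_; Bijection)
open import Relation.Binary.PropositionalEquality using (_≡_)

-- Subsets of ω are represented as characteristic functions ℕ → Bool
-- (classically this is the full power set of ω).
Subset : Set
Subset = ℕ → Bool

_⊆_ : Subset → Subset → Set
A ⊆ B = ∀ n → A n ≡ true → B n ≡ true

record Ultrafilter : Set where
  field
    mem    : Subset → Bool
    full   : mem (λ _ → true) ≡ true
    proper : mem (λ _ → false) ≡ false
    upward : ∀ A B → A ⊆ B → mem A ≡ true → mem B ≡ true
    inter  : ∀ A B → mem A ≡ true → mem B ≡ true → mem (λ n → A n ∧ B n) ≡ true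
    ultra  : ∀ A → mem A ≡ true ⊎ mem (λ n → not (A n)) ≡ true
open Ultrafilter public

IsPrincipalAt : Ultrafilter → ℕ → Set
IsPrincipalAt u k = ∀ A → mem u A ≡ A k

IsRKImage : (f : ℕ → ℕ) → Ultrafilter → Ultrafilter → Set
IsRKImage f u v = ∀ B → mem v B ≡ mem u (B ∘ f)

IsLimit : Ultrafilter → (ℕ → Ultrafilter) → Ultrafilter → Set
IsLimit p us v = ∀ A → mem v A ≡ mem p (λ n → mem (us n) A)

-- v is (extensionally) the Blass–Frolík sum Σ_u us, transported from
-- ω×ω to ω along the bijection π : ω×ω → ω, i.e. v = π(Σ_u us).
IsSum : (π : (ℕ × ℕ) ⤖ ℕ) → Ultrafilter → (ℕ → Ultrafilter) → Ultrafilter → Set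
IsSum π u us v =
  ∀ B → mem v B ≡ mem u (λ n → mem (us n) (λ m → B (Bijection.to π (n , m))))

data Ord : Set where
  zero : Ord
  suc  : Ord → Ord
  lim  : (ℕ → Ord) → Ord

-- G p α corresponds to 𝒢^p_{1+α}: G p zero = 𝒢^p_1 (principal ultrafilters),
-- G p (suc α) = p-limits of sequences in G p α, G p (lim f) = ⋃ₙ G p (f n).
G : Ultrafilter → Ord → Ultrafilter → Set
G p zero      u = Σ ℕ λ k → IsPrincipalAt u k
G p (suc α)   u = Σ (ℕ → Ultrafilter) λ us → (∀ n → G p α (us n)) × IsLimit p us u
G p (lim f)   u = Σ ℕ λ n → G p (f n) u

Gp : Ultrafilter → Ultrafilter → Set
Gp p u = Σ Ord λ α → G p α u

IsClosedFamily : Ultrafilter → (Ultrafilter → Set) → Set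
IsClosedFamily p F =
  (∀ u k → IsPrincipalAt u k → F u)
  × F p
  × (∀ f u v → F u → IsRKImage f u v → F v)
  × (∀ π u us v → F u → (∀ n → F (us n)) → IsSum π u us v → F v)

{-# OPTIONS --safe #-}
-- Two identities drive the proof: f(p-lim uₙ) = p-lim f(uₙ), and
-- Σ_{p-lim wₙ} uₙ = p-lim Σ_{wₙ} uₙ, while a sum indexed by the principal
-- ultrafilter at k is the image of u_k under m ↦ π(k , m).  Induction along
-- the hierarchy then closes 𝒢^p under images and sums, and p = p-lim of the
-- principal ultrafilters.  Conversely p-lim uₙ is the image of Σ_p uₙ under
-- the second coordinate, so a family satisfying (1)–(4) contains every 𝒢^p_α.
module Submission where

open import Defs
open import Data.Product using (_×_; _,_; proj₁; proj₂)
open import Data.Nat using (ℕ; zero; suc; _+_)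
open import Data.Nat.Properties using (+-suc; +-identityʳ; suc-injective)
open import Data.Bool using (Bool; true; false; not; _∧_)
open import Data.Bool.Properties using (∧-conicalˡ; ∧-conicalʳ)
open import Data.Sum using (_⊎_; inj₁; inj₂; map₂)
open import Function using (_∘_)
open import Function.Bundles using (_⤖_; Bijection; mk↔ₛ′)
open import Function.Properties.Inverse using (↔⇒⤖)
open import Relation.Binary.PropositionalEquality

triangle : ℕ → ℕ
triangle zero    = zero
triangle (suc k) = suc k + triangle k

pair : ℕ × ℕ → ℕ
pair (n , m) = n + triangle (n + m)

-- The successor in the Cantor enumeration of ℕ × ℕ along anti-diagonals.
next : ℕ × ℕ → ℕ × ℕ
next (n , suc m) = suc n , m
next (n , zero)  = zero , suc n

unpair : ℕ → ℕ × ℕ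
unpair zero    = zero , zero
unpair (suc k) = next (unpair k)

pair-next : ∀ x → pair (next x) ≡ suc (pair x)
pair-next (n , suc m) = cong (λ k → suc (n + triangle k)) (sym (+-suc n m))
pair-next (n , zero)  = cong (λ k → suc (n + triangle k)) (sym (+-identityʳ n))

pair-unpair : ∀ k → pair (unpair k) ≡ k
pair-unpair zero    = refl
pair-unpair (suc k) = trans (pair-next (unpair k)) (cong suc (pair-unpair k))

-- The index s makes the lexicographic induction (anti-diagonal, then first
-- coordinate) structural.
unpair-pair-on-diagonal : ∀ s n m → n + m ≡ s → unpair (pair (n , m)) ≡ (n , m)
unpair-pair-on-diagonal s       zero    zero    _ = refl
unpair-pair-on-diagonal zero    zero    (suc m) ()
unpair-pair-on-diagonal (suc s) zero    (suc m) n+m≡s =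
  trans (cong unpair (pair-next (m , zero)))
        (cong next (unpair-pair-on-diagonal s m zero
                     (trans (+-identityʳ m) (suc-injective n+m≡s))))
unpair-pair-on-diagonal s       (suc n) m       n+m≡s =
  trans (cong unpair (pair-next (n , suc m)))
        (cong next (unpair-pair-on-diagonal s n (suc m) (trans (+-suc n m) n+m≡s)))

unpair-pair : ∀ x → unpair (pair x) ≡ x
unpair-pair (n , m) = unpair-pair-on-diagonal (n + m) n m refl

pairing : (ℕ × ℕ) ⤖ ℕ
pairing = ↔⇒⤖ (mk↔ₛ′ pair unpair pair-unpair unpair-pair)

≡true-ext : ∀ {x y} → (x ≡ true → y ≡ true) → (y ≡ true → x ≡ true) → x ≡ y
≡true-ext {false} {false} _ _ = refl
≡true-ext {false} {true}  _ g = g refl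
≡true-ext {true}  {false} f _ = sym (f refl)
≡true-ext {true}  {true}  _ _ = refl

module _ (u : Ultrafilter) where

  mem-cong : ∀ A B → (∀ n → A n ≡ B n) → mem u A ≡ mem u B
  mem-cong A B A≗B = ≡true-ext (upward u A B (λ n → trans (sym (A≗B n))))
                               (upward u B A (λ n → trans (A≗B n)))

  mem-complement : ∀ A → not (mem u A) ≡ true → mem u (not ∘ A) ≡ true
  mem-complement A A∉u with ultra u A
  ... | inj₂ ∁A∈u = ∁A∈u
  ... | inj₁ A∈u with () ← trans (sym (cong not A∈u)) A∉u

principal : ℕ → Ultrafilter
principal k = record
  { mem    = λ A → A k
  ; full   = refl
  ; proper = refl
  ; upward = λ A B A⊆B → A⊆B k
  ; inter  = λ A B A∋k B∋k → subst (λ b → b ∧ B k ≡ true) (sym A∋k) B∋k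
  ; ultra  = λ A → excluded-middle (A k)
  }
  where
  excluded-middle : ∀ b → b ≡ true ⊎ not b ≡ true
  excluded-middle true  = inj₁ refl
  excluded-middle false = inj₂ refl

image : (ℕ → ℕ) → Ultrafilter → Ultrafilter
image f u = record
  { mem    = λ B → mem u (B ∘ f)
  ; full   = full u
  ; proper = proper u
  ; upward = λ A B A⊆B → upward u (A ∘ f) (B ∘ f) (A⊆B ∘ f)
  ; inter  = λ A B → inter u (A ∘ f) (B ∘ f)
  ; ultra  = λ A → ultra u (A ∘ f)
  }

sum : (ℕ × ℕ → ℕ) → Ultrafilter → (ℕ → Ultrafilter) → Ultrafilter
sum t u us = record
  { mem    = mem-sum
  ; full   = trans (mem-cong u _ _ (full ∘ us)) (full u)
  ; proper = trans (mem-cong u _ _ (proper ∘ us)) (proper u)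
  ; upward = λ A B A⊆B →
      upward u _ _ (λ n → upward (us n) _ _ (λ m → A⊆B (t (n , m))))
  ; inter  = λ A B A∈ B∈ →
      upward u _ _
        (λ n both → inter (us n) _ _ (∧-conicalˡ _ _ both) (∧-conicalʳ _ _ both))
        (inter u _ _ A∈ B∈)
  ; ultra  = λ A →
      map₂ (upward u _ _ (λ n → mem-complement (us n) _)) (ultra u (section A))
  }
  where
  section : Subset → Subset
  section B n = mem (us n) (λ m → B (t (n , m)))

  mem-sum : Subset → Bool
  mem-sum B = mem u (section B)

IsSum-sum : ∀ π u us → IsSum π u us (sum (Bijection.to π) u us)
IsSum-sum π u us B = refl

IsPrincipalAt-image : ∀ f u v k → IsPrincipalAt u k → IsRKImage f u v →
                      IsPrincipalAt v (f k)
IsPrincipalAt-image f u v k u=k v=fu B = trans (v=fu B) (u=k (B ∘ f))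

IsLimit-image : ∀ f p us u v → IsLimit p us u → IsRKImage f u v →
                IsLimit p (λ n → image f (us n)) v
IsLimit-image f p us u v u=lim v=fu B = trans (v=fu B) (u=lim (B ∘ f))

IsSum-principal : ∀ π u us v k → IsPrincipalAt u k → IsSum π u us v →
                  IsRKImage (λ m → Bijection.to π (k , m)) (us k) v
IsSum-principal π u us v k u=k v=Σ B = trans (v=Σ B) (u=k _)

IsSum-limit : ∀ π p ws u us v → IsLimit p ws u → IsSum π u us v →
              IsLimit p (λ n → sum (Bijection.to π) (ws n) us) v
IsSum-limit π p ws u us v u=lim v=Σ B = trans (v=Σ B) (u=lim _)

IsLimit-as-image-of-sum : ∀ t s p us v → (∀ n m → s (t (n , m)) ≡ m) →
                          IsLimit p us v → IsRKImage s (sum t p us) v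
IsLimit-as-image-of-sum t s p us v s∘t≡proj₂ v=lim B =
  trans (v=lim B)
        (mem-cong p _ _ λ n → mem-cong (us n) _ _ λ m → cong B (sym (s∘t≡proj₂ n m)))

module _ (p : Ultrafilter) where

  Gp-limit : ∀ us v → (∀ n → Gp p (us n)) → IsLimit p us v → Gp p v
  Gp-limit us v us∈Gp v=lim =
    suc (lim (λ n → proj₁ (us∈Gp n))) , us , (λ n → n , proj₂ (us∈Gp n)) , v=lim

  G-image : ∀ α f u v → G p α u → IsRKImage f u v → G p α v
  G-image zero     f u v (k , u=k)           v=fu = f k , IsPrincipalAt-image f u v k u=k v=fu
  G-image (suc α)  f u v (us , us∈G , u=lim) v=fu =
    (λ n → image f (us n)) ,
    (λ n → G-image α f (us n) (image f (us n)) (us∈G n) (λ B → refl)) ,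
    IsLimit-image f p us u v u=lim v=fu
  G-image (lim αs) f u v (n , u∈G)           v=fu = n , G-image (αs n) f u v u∈G v=fu

  G-sum : ∀ α π u us v → G p α u → (∀ n → Gp p (us n)) → IsSum π u us v → Gp p v
  G-sum zero     π u us v (k , u=k) us∈Gp v=Σ =
    let (β , uk∈G) = us∈Gp k
    in  β , G-image β (λ m → Bijection.to π (k , m)) (us k) v uk∈G
                    (IsSum-principal π u us v k u=k v=Σ)
  G-sum (suc α)  π u us v (ws , ws∈G , u=lim) us∈Gp v=Σ =
    Gp-limit vs v
      (λ n → G-sum α π (ws n) us (vs n) (ws∈G n) us∈Gp (IsSum-sum π (ws n) us))
      (IsSum-limit π p ws u us v u=lim v=Σ)
    where
    vs : ℕ → Ultrafilter
    vs n = sum (Bijection.to π) (ws n) us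
  G-sum (lim αs) π u us v (n , u∈G) us∈Gp v=Σ = G-sum (αs n) π u us v u∈G us∈Gp v=Σ

  Gp-closed : IsClosedFamily p (Gp p)
  Gp-closed =
    (λ u k u=k → zero , k , u=k) ,
    Gp-limit principal p (λ n → zero , n , λ A → refl) (λ A → refl) ,
    (λ f u v (α , u∈G) v=fu → α , G-image α f u v u∈G v=fu) ,
    (λ π u us v (α , u∈G) → G-sum α π u us v u∈G)

  G⊆closed : ∀ {F} → IsClosedFamily p F → ∀ α u → G p α u → F u
  G⊆closed (principal∈F , _ , _ , _) zero u (k , u=k) = principal∈F u k u=k
  G⊆closed F-closed@(_ , p∈F , image∈F , sum∈F) (suc α) u (us , us∈G , u=lim) =
    image∈F (λ k → proj₂ (unpair k)) Σpus u
      (sum∈F pairing p us Σpus p∈F (λ n → G⊆closed F-closed α (us n) (us∈G n))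
             (IsSum-sum pairing p us))
      (IsLimit-as-image-of-sum pair (λ k → proj₂ (unpair k)) p us u
        (λ n m → cong proj₂ (unpair-pair (n , m))) u=lim)
    where
    Σpus : Ultrafilter
    Σpus = sum pair p us
  G⊆closed F-closed (lim αs) u (n , u∈G) = G⊆closed F-closed (αs n) u u∈G

corollary3p12 : (p : Ultrafilter) →
    IsClosedFamily p (Gp p)
    × ((F : Ultrafilter → Set) → IsClosedFamily p F → ∀ u → Gp p u → F u)
corollary3p12 p = Gp-closed p , λ F F-closed u (α , u∈G) → G⊆closed p F-closed α u u∈G
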